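{- Let $n\in\mathbb{N}$ and let $R\subseteq\mathbb{Z}_n$ be a nonempty set having $n$ distinct translates $g+R$ ($g\in\mathbb{Z}_n$). Let $A=t+R$ be any translate of $R$, let $a\in R$ and put $a'=a+t\in A$. Let $l\in\{1,\dots,n\}$ and $m\in\{0,1,\dots,n-1\}$. Define, for $i\in\{0,1,\dots,n-1\}$, $$S_i=\begin{cases}\big((A+i)\setminus\{a'+i\}\big)\cup\{a'+((i+m)\bmod l)\} & \text{if } 0\le i\le l-1,\\ A+i & \text{if } l\le i\le n-1,\end{cases}$$ (i.e. the translates $a',a'+1,\dots,a'+(l-1)$ of $a$ in the sets $A,A+1,\dots,A+(l-1)$ are cyclically shifted by length $m$ among these sets), and let $\mathcal{F}'=\{S_0,\dots,S_{n-1}\}$. Then the union closed family $\langle\mathcal{F}'\rangle$ satisfies the Union Closed Conjecture: there is an element of $\mathbb{Z}_n$ that belongs to at least half of the members of $\langle\mathcal{F}'\rangle$.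
   Context: For $g\in\mathbb{Z}_n$ and $S\subseteq\mathbb{Z}_n$, $g+S=\{g+s:s\in S\}$. For a family $\mathcal{F}$ of sets, $\langle\mathcal{F}\rangle$ denotes the family of all unions of subfamilies of $\mathcal{F}$, including the empty set. A union closed family satisfies the Union Closed Conjecture if some element of its universe lies in at least half of its member sets. -}

module Defs where

open import Data.Nat as ℕ using (ℕ; zero; suc; NonZero; _%_)
open import Data.Nat.DivMod using (m%n<n)
open import Data.Fin as Fin using (Fin; toℕ; fromℕ<)
open import Data.Fin.Properties as FinP using (any?)
open import Data.Fin.Subset using (Subset; _∈_; _∪_; _-_; ⁅_⁆; ⋃; inside; outside)
open import Data.Fin.Subset.Properties using (_∈?_)
open import Data.Vec as Vec using (Vec; []; _∷_; tabulate)
import Data.Vec.Properties as VecP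
open import Data.Bool using (Bool)
import Data.Bool.Properties as BoolP
open import Data.List as List using (List; map; filter; deduplicate; length; allFin)
open import Data.Product using (_×_; _,_)
open import Relation.Nullary using (Dec; yes; no; does)
open import Relation.Nullary.Decidable using (⌊_⌋; _×-dec_)
open import Relation.Binary.PropositionalEquality using (_≡_)

-- Z_n is modelled by Fin n with addition modulo n.
-- (Fin 0 is empty, so the n = 0 case needs no special treatment.)
_⊕_ : ∀ {n} → Fin n → Fin n → Fin n
_⊕_ {suc k} x y = fromℕ< (m%n<n (toℕ x ℕ.+ toℕ y) (suc k))

_⊕ℕ_ : ∀ {n} → Fin n → ℕ → Fin n
_⊕ℕ_ {suc k} x j = fromℕ< (m%n<n (toℕ x ℕ.+ j) (suc k))

translate : ∀ {n} → Fin n → Subset n → Subset n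
translate {n} g S = tabulate λ y → ⌊ any? (λ s → (s ∈? S) ×-dec (g ⊕ s Fin.≟ y)) ⌋

_≟ˢ_ : ∀ {n} (X Y : Subset n) → Dec (X ≡ Y)
_≟ˢ_ = VecP.≡-dec BoolP._≟_

subsets : ∀ n → List (Subset n)
subsets zero = [] List.∷ List.[]
subsets (suc n) = map (inside ∷_) (subsets n) List.++ map (outside ∷_) (subsets n)

-- union of the subfamily { S i : i ∈ I } (the empty subfamily gives ∅)
unionOf : ∀ {n} → (Fin n → Subset n) → Subset n → Subset n
unionOf {n} S I = ⋃ (map S (filter (_∈? I) (allFin n)))

-- ⟨ F ⟩ for F = { S i : i ∈ Z_n }, as a duplicate-free list of its distinct member sets
generated : ∀ {n} → (Fin n → Subset n) → List (Subset n)
generated {n} S = deduplicate _≟ˢ_ (map (unionOf S) (subsets n))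

countContaining : ∀ {n} → Fin n → List (Subset n) → ℕ
countContaining x 𝓕 = length (filter (x ∈?_) 𝓕)

SatisfiesUCC : ∀ {n} → List (Subset n) → Set
SatisfiesUCC {n} 𝓕 = Data.Product.∃ λ (x : Fin n) → length 𝓕 ℕ.≤ 2 ℕ.* countContaining x 𝓕
  where import Data.Product

Smod : ∀ {n} (R : Subset n) (t a : Fin n) (l : ℕ) .{{_ : NonZero l}} (m : ℕ) → Fin n → Subset n
Smod R t a l m i with does (toℕ i ℕ.<? l)
... | Bool.true  = (translate i A - (i ⊕ a')) ∪ ⁅ a' ⊕ℕ ((toℕ i ℕ.+ m) % l) ⁆
  where A = translate t R
        a' = a ⊕ t
... | Bool.false = translate i (translate t R)

-- Let c = l − 1 and ι x = (a' + c) − x, a reflection of ℤₙ. The family is self-dual under ι: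
-- x ∈ Sᵢ implies ι i ∈ S_{ι x}. For the translates this is (ι i) − (ι x) = x − i; for the
-- modified sets it holds because the reversal p ↦ c − p of {0, …, c} conjugates the rotation
-- p ↦ (p + m) mod l into its inverse, so ι maps removed points to removed points and added
-- points to added points.
-- For a self-dual family, F ↦ ⋃ {S_{ι x} : x ∉ F} is an involution of ⟨S⟩. The sets Sⱼ have
-- distinct representatives a' + shift j, so it sends F to a member with at least n − |F|
-- elements. Hence the members of ⟨S⟩ have average size at least n/2, and double counting
-- gives an element that lies in at least half of them.

{-# OPTIONS --safe #-}
module Submission where

open import Defs
open import Level using (0ℓ)
open import Function using (_∘_)
open import Data.Nat
  using (ℕ; suc; NonZero; _+_; _*_; _∸_; _≤_; _<_; _≮_; _≤?_; _<?_; _<ᵇ_; z≤n; s≤s; s≤s⁻¹)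
open import Data.Nat.Properties
  using ( +-suc; +-comm; +-assoc; +-identityʳ; *-comm; *-zeroʳ; *-identityʳ; *-distribˡ-+
        ; ≤-reflexive; ≤-trans; ≤-<-trans; <⇒≤; ≰⇒>; +-mono-≤; +-monoˡ-≤; +-monoʳ-≤; +-cancelˡ-≤
        ; m∸n+n≡m; m∸n≤m; m∸[m∸n]≡n; <ᵇ-reflects-<; +-commutativeSemigroup; module ≤-Reasoning)
open import Data.Nat.DivMod using (_%_; m%n<n; %-distribˡ-+; m%n%n≡m%n; m<n⇒m%n≡m; n%n≡0)
open import Data.Nat.ListAction using (sum)
open import Data.Bool using (true; false; if_then_else_)
open import Data.Bool.Properties using (T-≡)
open import Data.Fin as Fin using (Fin; toℕ; fromℕ<)
open import Data.Fin.Properties using (any?; toℕ-fromℕ<; toℕ-fromℕ; toℕ<n; toℕ-injective)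
open import Data.Fin.Subset using (Subset; _∈_; _∉_; _⊆_; _∪_; _─_; _-_; ⁅_⁆; ∁; ⋃; inside; outside; Nonempty)
open import Data.Fin.Subset.Properties
  using ( _∈?_; x∈p∪q⁻; x∈p∪q⁺; ∉⊥; ⊆-antisym; x∉p⇒x∈∁p; x∈∁p⇒x∉p
        ; x∈⁅x⁆; x∈⁅y⁆⇒x≡y; x∈p∧x≢y⇒x∈p-y; p─q⊆p)
open import Data.Vec as Vec using (tabulate; _∷_; here; there)
open import Data.Vec.Properties using (lookup∘tabulate; []=⇒lookup; lookup⇒[]=)
open import Data.List as List using (List; []; _∷_; map; filter; length; allFin)
open import Data.List.Properties using (filter-all; map-∘; map-cong; length-tabulate)
open import Data.List.Relation.Unary.All as All using ()
open import Data.List.Relation.Unary.All.Properties using () renaming (map⁺ to All-map⁺)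
open import Data.List.Relation.Unary.Any using (here; there)
open import Data.List.Relation.Unary.AllPairs using ([]; _∷_)
open import Data.List.Relation.Unary.Unique.Propositional using (Unique)
open import Data.List.Relation.Unary.Unique.Propositional.Properties using (filter⁺; allFin⁺)
open import Data.List.Relation.Unary.Unique.DecPropositional.Properties using (deduplicate-!)
open import Data.List.Membership.Propositional using () renaming (_∈_ to _∈ₗ_)
open import Data.List.Membership.Propositional.Properties
  using (∈-filter⁻; ∈-filter⁺; ∈-map⁻; ∈-map⁺; ∈-allFin; ∈-++⁺ˡ; ∈-++⁺ʳ; ∈-deduplicate⁻; ∈-deduplicate⁺)
open import Data.List.Relation.Binary.Subset.Propositional using () renaming (_⊆_ to _⊆ₗ_)
open import Data.Product using (∃; _×_; _,_; proj₁; proj₂)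
open import Data.Sum using (_⊎_; inj₁; inj₂; [_,_]′)
open import Function.Bundles using (Equivalence)
open import Algebra.Bundles using (AbelianGroup)
open import Algebra.Consequences.Propositional using (comm∧idˡ⇒id; comm∧invˡ⇒inv)
open import Algebra.Properties.CommutativeSemigroup +-commutativeSemigroup
  using () renaming (interchange to +-interchange; x∙yz≈y∙xz to +-x∙yz≈y∙xz)
open import Relation.Nullary using (¬_; Dec; yes; no; ¬?; does; contradiction; ofʸ; ofⁿ)
open import Relation.Nullary.Decidable using (⌊_⌋; toWitness; fromWitness; toSum; _×-dec_)
open import Relation.Unary using (Pred; Decidable)
open import Relation.Unary.Properties using (∁?)
open import Relation.Binary using (DecidableEquality)
open import Relation.Binary.PropositionalEquality

private variable
  X Y : Set

∑ : (X → ℕ) → List X → ℕ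
∑ f xs = sum (map f xs)

∑-distrib-+ : ∀ (f g : X → ℕ) xs → ∑ (λ x → f x + g x) xs ≡ ∑ f xs + ∑ g xs
∑-distrib-+ f g []       = refl
∑-distrib-+ f g (x ∷ xs) = trans (cong (f x + g x +_) (∑-distrib-+ f g xs)) (+-interchange (f x) (g x) _ _)

∑-mono-≤ : ∀ {f g : X → ℕ} → (∀ x → f x ≤ g x) → ∀ xs → ∑ f xs ≤ ∑ g xs
∑-mono-≤ f≤g []       = z≤n
∑-mono-≤ f≤g (x ∷ xs) = +-mono-≤ (f≤g x) (∑-mono-≤ f≤g xs)

∑-const : ∀ c (xs : List X) → ∑ (λ _ → c) xs ≡ length xs * c
∑-const c []       = refl
∑-const c (x ∷ xs) = cong (c +_) (∑-const c xs)

∑-*ˡ : ∀ c (f : X → ℕ) xs → ∑ (λ x → c * f x) xs ≡ c * ∑ f xs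
∑-*ˡ c f []       = sym (*-zeroʳ c)
∑-*ˡ c f (x ∷ xs) = trans (cong (c * f x +_) (∑-*ˡ c f xs)) (sym (*-distribˡ-+ c (f x) (∑ f xs)))

∑-comm : ∀ (h : X → Y → ℕ) as bs → ∑ (λ a → ∑ (h a) bs) as ≡ ∑ (λ b → ∑ (λ a → h a b) as) bs
∑-comm h []       bs = sym (trans (∑-const 0 bs) (*-zeroʳ (length bs)))
∑-comm h (a ∷ as) bs = trans (cong (∑ (h a) bs +_) (∑-comm h as bs))
                             (sym (∑-distrib-+ (h a) (λ b → ∑ (λ a → h a b) as) bs))

module _ {P : Pred X 0ℓ} (P? : Decidable P) where

  length-filter≡∑ : ∀ xs → length (filter P? xs) ≡ ∑ (λ x → if does (P? x) then 1 else 0) xs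
  length-filter≡∑ []       = refl
  length-filter≡∑ (x ∷ xs) with does (P? x)
  ... | true  = cong suc (length-filter≡∑ xs)
  ... | false = length-filter≡∑ xs

  length-filter+length-filter-∁ : ∀ xs → length (filter P? xs) + length (filter (∁? P?) xs) ≡ length xs
  length-filter+length-filter-∁ []       = refl
  length-filter+length-filter-∁ (x ∷ xs) with P? x
  ... | yes _ = cong suc (length-filter+length-filter-∁ xs)
  ... | no  _ = trans (+-suc _ _) (cong suc (length-filter+length-filter-∁ xs))

∑-length-filter-comm : ∀ {R : X → Y → Set} (R? : ∀ a b → Dec (R a b)) as bs →
  ∑ (λ a → length (filter (R? a) bs)) as ≡ ∑ (λ b → length (filter (λ a → R? a b) as)) bs
∑-length-filter-comm R? as bs = begin
  ∑ (λ a → length (filter (R? a) bs)) as          ≡⟨ cong sum (map-cong (λ a → length-filter≡∑ (R? a) bs) as) ⟩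
  ∑ (λ a → ∑ (χ a) bs) as                         ≡⟨ ∑-comm χ as bs ⟩
  ∑ (λ b → ∑ (λ a → χ a b) as) bs                 ≡⟨ cong sum (map-cong (λ b → length-filter≡∑ (λ a → R? a b) as) bs) ⟨
  ∑ (λ b → length (filter (λ a → R? a b) as)) bs  ∎
  where
  open ≡-Reasoning
  χ : ∀ a b → ℕ
  χ a b = if does (R? a b) then 1 else 0

map⁺-injectiveOn : ∀ {f : X → Y} {xs} → Unique xs → (∀ {a b} → a ∈ₗ xs → b ∈ₗ xs → f a ≡ f b → a ≡ b) →
                   Unique (map f xs)
map⁺-injectiveOn {xs = []}     []           _   = []
map⁺-injectiveOn {xs = x ∷ xs} (x∉xs ∷ !xs) inj =
  All-map⁺ (All.tabulate λ y∈xs fx≡fy → All.lookup x∉xs y∈xs (inj (here refl) (there y∈xs) fx≡fy))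
  ∷ map⁺-injectiveOn !xs (λ a∈ b∈ → inj (there a∈) (there b∈))

module _ (_≟_ : DecidableEquality Y) (g : Y → ℕ) where

  private
    others : Y → List Y → List Y
    others x = filter (λ y → ¬? (y ≟ x))

    ∑-split : ∀ x {ys} → Unique ys → ∑ g ys ≤ g x + ∑ g (others x ys)
    ∑-split x {[]}     _              = z≤n
    ∑-split x {y ∷ ys} (y∉ys ∷ !ys) with y ≟ x
    ... | yes refl = ≤-reflexive (cong (λ zs → g y + ∑ g zs)
                       (sym (filter-all (λ z → ¬? (z ≟ y)) (All.map (λ y≢z z≡y → y≢z (sym z≡y)) y∉ys))))
    ... | no  _    = ≤-trans (+-monoʳ-≤ (g y) (∑-split x !ys)) (≤-reflexive (+-x∙yz≈y∙xz (g y) (g x) _))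

  ∑-mono-⊆ : ∀ xs {ys} → Unique ys → ys ⊆ₗ xs → ∑ g ys ≤ ∑ g xs
  ∑-mono-⊆ []       {[]}    _   _     = z≤n
  ∑-mono-⊆ []       {y ∷ _} _   ys⊆[] with () ← ys⊆[] (here refl)
  ∑-mono-⊆ (x ∷ xs) {ys}    !ys ys⊆xxs =
    ≤-trans (∑-split x !ys) (+-monoʳ-≤ (g x) (∑-mono-⊆ xs (filter⁺ _ !ys) others⊆xs))
    where
    others⊆xs : others x ys ⊆ₗ xs
    others⊆xs z∈ with ∈-filter⁻ (λ y → ¬? (y ≟ x)) z∈
    ... | z∈ys , z≢x with ys⊆xxs z∈ys
    ...   | here z≡x = contradiction z≡x z≢x
    ...   | there z∈xs = z∈xs

  ∑-≤-injection : ∀ {f : X → Y} {xs ys} → Unique xs → (∀ {a b} → a ∈ₗ xs → b ∈ₗ xs → f a ≡ f b → a ≡ b) →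
                  (∀ {a} → a ∈ₗ xs → f a ∈ₗ ys) → ∑ (λ a → g (f a)) xs ≤ ∑ g ys
  ∑-≤-injection {f = f} {xs} {ys} !xs inj f∈ys = begin
    ∑ (λ a → g (f a)) xs ≡⟨ cong sum (map-∘ xs) ⟩
    ∑ g (map f xs)       ≤⟨ ∑-mono-⊆ ys (map⁺-injectiveOn !xs inj) image⊆ys ⟩
    ∑ g ys               ∎
    where
    open ≤-Reasoning
    image⊆ys : map f xs ⊆ₗ ys
    image⊆ys z∈ with _ , a∈xs , refl ← ∈-map⁻ f z∈ = f∈ys a∈xs

length-≤-injection : DecidableEquality Y → ∀ {f : X → Y} {xs ys} → Unique xs →
                     (∀ {a b} → a ∈ₗ xs → b ∈ₗ xs → f a ≡ f b → a ≡ b) → (∀ {a} → a ∈ₗ xs → f a ∈ₗ ys) →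
                     length xs ≤ length ys
length-≤-injection _≟_ {xs = xs} {ys} !xs inj f∈ys =
  subst₂ _≤_ (∑-const1 xs) (∑-const1 ys) (∑-≤-injection _≟_ (λ _ → 1) !xs inj f∈ys)
  where
  ∑-const1 : ∀ {C : Set} (zs : List C) → ∑ (λ _ → 1) zs ≡ length zs
  ∑-const1 zs = trans (∑-const 1 zs) (*-identityʳ (length zs))

averaging : ∀ (f : X → ℕ) c x xs → length (x ∷ xs) * c ≤ ∑ f (x ∷ xs) → ∃ λ y → c ≤ f y
averaging f c x xs avg with c ≤? f x
... | yes c≤fx = x , c≤fx
averaging f c x []       avg | no c≰fx = contradiction (subst₂ _≤_ (+-identityʳ c) (+-identityʳ (f x)) avg) c≰fx
averaging f c x (y ∷ ys) avg | no c≰fx =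
  averaging f c y ys (+-cancelˡ-≤ c _ _ (≤-trans avg (+-monoˡ-≤ _ (<⇒≤ (≰⇒> c≰fx)))))

∈-tabulate⁻ : ∀ {n} {P : Pred (Fin n) 0ℓ} (P? : Decidable P) {x} → x ∈ tabulate (λ y → ⌊ P? y ⌋) → P x
∈-tabulate⁻ P? {x} x∈ = toWitness (Equivalence.from T-≡ (trans (sym (lookup∘tabulate _ x)) ([]=⇒lookup x∈)))

∈-tabulate⁺ : ∀ {n} {P : Pred (Fin n) 0ℓ} (P? : Decidable P) {x} → P x → x ∈ tabulate (λ y → ⌊ P? y ⌋)
∈-tabulate⁺ P? {x} px = lookup⇒[]= x _ (trans (lookup∘tabulate _ x) (Equivalence.to T-≡ (fromWitness px)))

image : ∀ {m n} → (Fin m → Fin n) → Subset m → Subset n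
image f p = tabulate λ y → ⌊ any? (λ x → (x ∈? p) ×-dec (f x Fin.≟ y)) ⌋

∈-image⁻ : ∀ {m n} (f : Fin m → Fin n) {p y} → y ∈ image f p → ∃ λ x → x ∈ p × f x ≡ y
∈-image⁻ f {p} = ∈-tabulate⁻ (λ y → any? (λ x → (x ∈? p) ×-dec (f x Fin.≟ y)))

∈-image⁺ : ∀ {m n} (f : Fin m → Fin n) {p x} → x ∈ p → f x ∈ image f p
∈-image⁺ f {p} {x} x∈p = ∈-tabulate⁺ (λ y → any? (λ x → (x ∈? p) ×-dec (f x Fin.≟ y))) (x , x∈p , refl)

x∈p─q⇒x∉q : ∀ {n} {p q : Subset n} {x} → x ∈ p ─ q → x ∉ q
x∈p─q⇒x∉q {p = _ ∷ _} {inside  ∷ _} {Fin.zero}  ()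
x∈p─q⇒x∉q {p = _ ∷ _} {outside ∷ _} {Fin.zero}  _         ()
x∈p─q⇒x∉q {p = _ ∷ _} {_       ∷ _} {Fin.suc x} (there x∈) (there x∈q) = x∈p─q⇒x∉q x∈ x∈q

∈-[p-y]∪⁅z⁆⁻ : ∀ {n} (p : Subset n) y z {x} → x ∈ (p - y) ∪ ⁅ z ⁆ → (x ∈ p × x ≢ y) ⊎ x ≡ z
∈-[p-y]∪⁅z⁆⁻ p y z x∈ with x∈p∪q⁻ (p - y) ⁅ z ⁆ x∈
... | inj₁ x∈p-y = inj₁ (p─q⊆p p ⁅ y ⁆ x∈p-y , λ { refl → x∈p─q⇒x∉q x∈p-y (x∈⁅x⁆ y) })
... | inj₂ x∈⁅z⁆ = inj₂ (x∈⁅y⁆⇒x≡y z x∈⁅z⁆)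

∈-[p-y]∪⁅z⁆⁺ : ∀ {n} (p : Subset n) y z {x} → (x ∈ p × x ≢ y) ⊎ x ≡ z → x ∈ (p - y) ∪ ⁅ z ⁆
∈-[p-y]∪⁅z⁆⁺ p y z (inj₁ (x∈p , x≢y)) = x∈p∪q⁺ {p = p - y} {q = ⁅ z ⁆} (inj₁ (x∈p∧x≢y⇒x∈p-y x∈p x≢y))
∈-[p-y]∪⁅z⁆⁺ p y z (inj₂ refl)        = x∈p∪q⁺ {p = p - y} {q = ⁅ z ⁆} (inj₂ (x∈⁅x⁆ z))

-- Defs' translate g p is literally image (g ⊕_) p.
∈-translate⁻ : ∀ {n} (g : Fin n) p {y} → y ∈ translate g p → ∃ λ s → s ∈ p × g ⊕ s ≡ y
∈-translate⁻ g p = ∈-image⁻ (g ⊕_) {p}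

∈-translate⁺ : ∀ {n} (g : Fin n) p {s} → s ∈ p → g ⊕ s ∈ translate g p
∈-translate⁺ g p = ∈-image⁺ (g ⊕_) {p}

x∈⋃⁻ : ∀ {n} {x : Fin n} ps → x ∈ ⋃ ps → ∃ λ p → p ∈ₗ ps × x ∈ p
x∈⋃⁻ []       x∈ = contradiction x∈ ∉⊥
x∈⋃⁻ (p ∷ ps) x∈ with x∈p∪q⁻ p (⋃ ps) x∈
... | inj₁ x∈p  = p , here refl , x∈p
... | inj₂ x∈ps with q , q∈ps , x∈q ← x∈⋃⁻ ps x∈ps = q , there q∈ps , x∈q

x∈⋃⁺ : ∀ {n} {x : Fin n} {p ps} → p ∈ₗ ps → x ∈ p → x ∈ ⋃ ps
x∈⋃⁺ (here refl)  x∈p = x∈p∪q⁺ (inj₁ x∈p)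
x∈⋃⁺ (there p∈ps) x∈p = x∈p∪q⁺ (inj₂ (x∈⋃⁺ p∈ps x∈p))

∈-subsets : ∀ {n} (I : Subset n) → I ∈ₗ subsets n
∈-subsets Vec.[]            = here refl
∈-subsets (inside Vec.∷ I)  = ∈-++⁺ˡ (∈-map⁺ (inside Vec.∷_) (∈-subsets I))
∈-subsets (outside Vec.∷ I) = ∈-++⁺ʳ _ (∈-map⁺ (outside Vec.∷_) (∈-subsets I))

module _ {n} (S : Fin n → Subset n) where

  ∈-unionOf⁻ : ∀ {I y} → y ∈ unionOf S I → ∃ λ i → i ∈ I × y ∈ S i
  ∈-unionOf⁻ {I} y∈ with x∈⋃⁻ (map S (filter (_∈? I) (allFin n))) y∈
  ... | _ , Si∈ , y∈Si with ∈-map⁻ S Si∈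
  ...   | i , i∈ , refl = i , proj₂ (∈-filter⁻ (_∈? I) {xs = allFin n} i∈) , y∈Si

  ∈-unionOf⁺ : ∀ {I i y} → i ∈ I → y ∈ S i → y ∈ unionOf S I
  ∈-unionOf⁺ {I} {i} i∈I = x∈⋃⁺ (∈-map⁺ S (∈-filter⁺ (_∈? I) (∈-allFin i) i∈I))

  ∈-generated⁻ : ∀ {F} → F ∈ₗ generated S → ∃ λ I → F ≡ unionOf S I
  ∈-generated⁻ F∈ with I , _ , F≡ ← ∈-map⁻ (unionOf S) (∈-deduplicate⁻ _≟ˢ_ _ F∈) = I , F≡

  unionOf∈generated : ∀ I → unionOf S I ∈ₗ generated S
  unionOf∈generated I = ∈-deduplicate⁺ _≟ˢ_ (∈-map⁺ (unionOf S) (∈-subsets I))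

card : ∀ {n} → Subset n → ℕ
card {n} F = length (filter (_∈? F) (allFin n))

ucc-from-average : ∀ {n} .{{_ : NonZero n}} (𝓕 : List (Subset n)) →
                   length 𝓕 * n ≤ 2 * ∑ card 𝓕 → SatisfiesUCC 𝓕
ucc-from-average {suc k} 𝓕 avg = averaging twiceCount (length 𝓕) Fin.zero (List.tabulate Fin.suc) (begin
  length (allFin (suc k)) * length 𝓕      ≡⟨ cong (_* length 𝓕) (length-tabulate {n = suc k} (λ x → x)) ⟩
  suc k * length 𝓕                        ≡⟨ *-comm (suc k) (length 𝓕) ⟩
  length 𝓕 * suc k                        ≤⟨ avg ⟩
  2 * ∑ card 𝓕                            ≡⟨ cong (2 *_) (∑-length-filter-comm (λ F x → x ∈? F) 𝓕 xs) ⟩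
  2 * ∑ (λ x → countContaining x 𝓕) xs    ≡⟨ ∑-*ˡ 2 (λ x → countContaining x 𝓕) xs ⟨
  ∑ twiceCount xs                         ∎)
  where
  open ≤-Reasoning
  xs : List (Fin (suc k))
  xs = allFin (suc k)
  twiceCount : Fin (suc k) → ℕ
  twiceCount x = 2 * countContaining x 𝓕

module SelfDual {n} (S : Fin n → Subset n) (ι : Fin n → Fin n) (ι-involutive : ∀ x → ι (ι x) ≡ x)
                (∈-dual : ∀ {x i} → x ∈ S i → ι i ∈ S (ι x))
                (τ : Fin n → Fin n) (τ-injective : ∀ {i j} → τ i ≡ τ j → i ≡ j) (τ∈S : ∀ i → τ i ∈ S i) where

  ∈-dual⁻¹ : ∀ {x i} → ι i ∈ S (ι x) → x ∈ S i
  ∈-dual⁻¹ {x} {i} ιi∈ = subst₂ (λ u v → u ∈ S v) (ι-involutive x) (ι-involutive i) (∈-dual ιi∈)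

  ι-injective : ∀ {x y} → ι x ≡ ι y → x ≡ y
  ι-injective {x} {y} ιx≡ιy = begin
    x       ≡⟨ ι-involutive x ⟨
    ι (ι x) ≡⟨ cong ι ιx≡ιy ⟩
    ι (ι y) ≡⟨ ι-involutive y ⟩
    y       ∎
    where open ≡-Reasoning

  dual : Subset n → Subset n
  dual F = unionOf S (image ι (∁ F))

  ∈-dual⁺ : ∀ {F x y} → x ∉ F → y ∈ S (ι x) → y ∈ dual F
  ∈-dual⁺ x∉F = ∈-unionOf⁺ S (∈-image⁺ ι (x∉p⇒x∈∁p x∉F))

  ∈-dual⁻ : ∀ {F y} → y ∈ dual F → ∃ λ x → x ∉ F × y ∈ S (ι x)
  ∈-dual⁻ y∈ with _ , i∈ , y∈Si ← ∈-unionOf⁻ S y∈ with x , x∈∁F , refl ← ∈-image⁻ ι i∈ =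
    x , x∈∁p⇒x∉p x∈∁F , y∈Si

  dual-dual-⊆ : ∀ F → dual (dual F) ⊆ F
  dual-dual-⊆ F {y} y∈ with x , x∉dualF , y∈Sιx ← ∈-dual⁻ y∈ with y ∈? F
  ... | yes y∈F = y∈F
  ... | no  y∉F = contradiction (∈-dual⁺ y∉F (subst (λ z → z ∈ S (ι y)) (ι-involutive x) (∈-dual y∈Sιx))) x∉dualF

  ⊆-dual-dual : ∀ I → unionOf S I ⊆ dual (dual (unionOf S I))
  ⊆-dual-dual I {y} y∈ with i , i∈I , y∈Si ← ∈-unionOf⁻ S y∈ =
    ∈-dual⁺ ιi∉dual (subst (λ j → y ∈ S j) (sym (ι-involutive i)) y∈Si)
    where
    ιi∉dual : ι i ∉ dual (unionOf S I)
    ιi∉dual ιi∈ with z , z∉⋃SI , ιi∈Sιz ← ∈-dual⁻ ιi∈ = z∉⋃SI (∈-unionOf⁺ S i∈I (∈-dual⁻¹ ιi∈Sιz))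

  dual-involutive : ∀ {F} → F ∈ₗ generated S → dual (dual F) ≡ F
  dual-involutive F∈ with I , refl ← ∈-generated⁻ S F∈ = ⊆-antisym (dual-dual-⊆ (unionOf S I)) (⊆-dual-dual I)

  n≤card+card-dual : ∀ F → n ≤ card F + card (dual F)
  n≤card+card-dual F = begin
    n                         ≡⟨ length-tabulate {n = n} (λ x → x) ⟨
    length (allFin n)         ≡⟨ length-filter+length-filter-∁ (_∈? F) (allFin n) ⟨
    card F + length outside-F ≤⟨ +-monoʳ-≤ (card F) (length-≤-injection Fin._≟_ !outside-F ρ-injective ρ∈dual) ⟩
    card F + card (dual F)    ∎
    where
    open ≤-Reasoning
    outside-F : List (Fin n)
    outside-F = filter (∁? (_∈? F)) (allFin n)
    !outside-F : Unique outside-F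
    !outside-F = filter⁺ (∁? (_∈? F)) (allFin⁺ n)
    ρ-injective : ∀ {x y} → x ∈ₗ outside-F → y ∈ₗ outside-F → τ (ι x) ≡ τ (ι y) → x ≡ y
    ρ-injective _ _ ρx≡ρy = ι-injective (τ-injective ρx≡ρy)
    ρ∈dual : ∀ {x} → x ∈ₗ outside-F → τ (ι x) ∈ₗ filter (_∈? dual F) (allFin n)
    ρ∈dual {x} x∈ = ∈-filter⁺ (_∈? dual F) (∈-allFin _)
                      (∈-dual⁺ (proj₂ (∈-filter⁻ (∁? (_∈? F)) {xs = allFin n} x∈)) (τ∈S (ι x)))

  selfDual⇒UCC : .{{_ : NonZero n}} → SatisfiesUCC (generated S)
  selfDual⇒UCC = ucc-from-average 𝓕 (begin
    length 𝓕 * n                       ≡⟨ ∑-const n 𝓕 ⟨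
    ∑ (λ _ → n) 𝓕                      ≤⟨ ∑-mono-≤ n≤card+card-dual 𝓕 ⟩
    ∑ (λ F → card F + card (dual F)) 𝓕 ≡⟨ ∑-distrib-+ card (λ F → card (dual F)) 𝓕 ⟩
    ∑ card 𝓕 + ∑ (λ F → card (dual F)) 𝓕
      ≤⟨ +-monoʳ-≤ (∑ card 𝓕) (∑-≤-injection _≟ˢ_ card !𝓕 dual-injective (λ {F} _ → dual∈𝓕 F)) ⟩
    ∑ card 𝓕 + ∑ card 𝓕                ≡⟨ cong (∑ card 𝓕 +_) (+-identityʳ (∑ card 𝓕)) ⟨
    2 * ∑ card 𝓕                       ∎)
    where
    open ≤-Reasoning
    𝓕 : List (Subset n)
    𝓕 = generated S
    !𝓕 : Unique 𝓕
    !𝓕 = deduplicate-! _≟ˢ_ (map (unionOf S) (subsets n))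
    dual∈𝓕 : ∀ F → dual F ∈ₗ 𝓕
    dual∈𝓕 F = unionOf∈generated S (image ι (∁ F))
    dual-injective : ∀ {F G} → F ∈ₗ 𝓕 → G ∈ₗ 𝓕 → dual F ≡ dual G → F ≡ G
    dual-injective F∈ G∈ dualF≡dualG =
      trans (sym (dual-involutive F∈)) (trans (cong dual dualF≡dualG) (dual-involutive G∈))

[m%n+k]%n≡[m+k]%n : ∀ m k n .{{_ : NonZero n}} → (m % n + k) % n ≡ (m + k) % n
[m%n+k]%n≡[m+k]%n m k n = begin
  (m % n + k) % n           ≡⟨ %-distribˡ-+ (m % n) k n ⟩
  (m % n % n + k % n) % n   ≡⟨ cong (λ u → (u + k % n) % n) (m%n%n≡m%n m n) ⟩
  (m % n + k % n) % n       ≡⟨ %-distribˡ-+ m k n ⟨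
  (m + k) % n               ∎
  where open ≡-Reasoning

[m+k%n]%n≡[m+k]%n : ∀ m k n .{{_ : NonZero n}} → (m + k % n) % n ≡ (m + k) % n
[m+k%n]%n≡[m+k]%n m k n = begin
  (m + k % n) % n ≡⟨ cong (_% n) (+-comm m (k % n)) ⟩
  (k % n + m) % n ≡⟨ [m%n+k]%n≡[m+k]%n k m n ⟩
  (k + m) % n     ≡⟨ cong (_% n) (+-comm k m) ⟩
  (m + k) % n     ∎
  where open ≡-Reasoning

module _ {k : ℕ} where

  private
    n : ℕ
    n = suc k

  toℕ-⊕ : ∀ (x y : Fin n) → toℕ (x ⊕ y) ≡ (toℕ x + toℕ y) % n
  toℕ-⊕ x y = toℕ-fromℕ< _

  neg : Fin n → Fin n
  neg x = fromℕ< (m%n<n (n ∸ toℕ x) n)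

  _⊖_ : Fin n → Fin n → Fin n
  x ⊖ y = x ⊕ neg y

  ⊕-comm : ∀ (x y : Fin n) → x ⊕ y ≡ y ⊕ x
  ⊕-comm x y = toℕ-injective (begin
    toℕ (x ⊕ y)           ≡⟨ toℕ-⊕ x y ⟩
    (toℕ x + toℕ y) % n   ≡⟨ cong (_% n) (+-comm (toℕ x) (toℕ y)) ⟩
    (toℕ y + toℕ x) % n   ≡⟨ toℕ-⊕ y x ⟨
    toℕ (y ⊕ x)           ∎)
    where open ≡-Reasoning

  ⊕-assoc : ∀ (x y z : Fin n) → (x ⊕ y) ⊕ z ≡ x ⊕ (y ⊕ z)
  ⊕-assoc x y z = toℕ-injective (begin
    toℕ ((x ⊕ y) ⊕ z)                  ≡⟨ toℕ-⊕ (x ⊕ y) z ⟩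
    (toℕ (x ⊕ y) + toℕ z) % n          ≡⟨ cong (λ u → (u + toℕ z) % n) (toℕ-⊕ x y) ⟩
    ((toℕ x + toℕ y) % n + toℕ z) % n  ≡⟨ [m%n+k]%n≡[m+k]%n (toℕ x + toℕ y) (toℕ z) n ⟩
    (toℕ x + toℕ y + toℕ z) % n        ≡⟨ cong (_% n) (+-assoc (toℕ x) (toℕ y) (toℕ z)) ⟩
    (toℕ x + (toℕ y + toℕ z)) % n      ≡⟨ [m+k%n]%n≡[m+k]%n (toℕ x) (toℕ y + toℕ z) n ⟨
    (toℕ x + (toℕ y + toℕ z) % n) % n  ≡⟨ cong (λ u → (toℕ x + u) % n) (toℕ-⊕ y z) ⟨
    (toℕ x + toℕ (y ⊕ z)) % n          ≡⟨ toℕ-⊕ x (y ⊕ z) ⟨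
    toℕ (x ⊕ (y ⊕ z))                  ∎)
    where open ≡-Reasoning

  ⊕-identityˡ : ∀ (x : Fin n) → Fin.zero ⊕ x ≡ x
  ⊕-identityˡ x = toℕ-injective (trans (toℕ-⊕ Fin.zero x) (m<n⇒m%n≡m (toℕ<n x)))

  ⊕-inverseˡ : ∀ (x : Fin n) → neg x ⊕ x ≡ Fin.zero
  ⊕-inverseˡ x = toℕ-injective (begin
    toℕ (neg x ⊕ x)               ≡⟨ toℕ-⊕ (neg x) x ⟩
    (toℕ (neg x) + toℕ x) % n     ≡⟨ cong (λ u → (u + toℕ x) % n) (toℕ-fromℕ< (m%n<n (n ∸ toℕ x) n)) ⟩
    ((n ∸ toℕ x) % n + toℕ x) % n ≡⟨ [m%n+k]%n≡[m+k]%n (n ∸ toℕ x) (toℕ x) n ⟩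
    (n ∸ toℕ x + toℕ x) % n       ≡⟨ cong (_% n) (m∸n+n≡m (<⇒≤ (toℕ<n x))) ⟩
    n % n                         ≡⟨ n%n≡0 n ⟩
    0                             ∎)
    where open ≡-Reasoning

  ⊕-abelianGroup : AbelianGroup 0ℓ 0ℓ
  ⊕-abelianGroup = record
    { Carrier = Fin n
    ; _≈_ = _≡_
    ; _∙_ = _⊕_
    ; ε = Fin.zero
    ; _⁻¹ = neg
    ; isAbelianGroup = record
      { isGroup = record
        { isMonoid = record
          { isSemigroup = record
            { isMagma = record { isEquivalence = isEquivalence ; ∙-cong = cong₂ _⊕_ }
            ; assoc = ⊕-assoc }
          ; identity = comm∧idˡ⇒id ⊕-comm ⊕-identityˡ }
        ; inverse = comm∧invˡ⇒inv ⊕-comm ⊕-inverseˡ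
        ; ⁻¹-cong = cong neg }
      ; comm = ⊕-comm } }

  open AbelianGroup ⊕-abelianGroup using (assoc; identityˡ; identityʳ; inverseˡ; inverseʳ)
  open import Algebra.Properties.AbelianGroup ⊕-abelianGroup
    using (⁻¹-anti-homo-//; ⁻¹-∙-comm; xyx⁻¹≈y; ∙-cancelˡ; x≈z//y)
  open import Algebra.Properties.CommutativeSemigroup (AbelianGroup.commutativeSemigroup ⊕-abelianGroup)
    using () renaming (interchange to ⊕-interchange)

  ⊕-cancelˡ : ∀ (x : Fin n) {y z} → x ⊕ y ≡ x ⊕ z → y ≡ z
  ⊕-cancelˡ x = ∙-cancelˡ x _ _

  x⊖[x⊖y]≡y : ∀ (x y : Fin n) → x ⊖ (x ⊖ y) ≡ y
  x⊖[x⊖y]≡y x y = begin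
    x ⊕ neg (x ⊖ y) ≡⟨ cong (x ⊕_) (⁻¹-anti-homo-// x y) ⟩
    x ⊕ (y ⊖ x)     ≡⟨ assoc x y (neg x) ⟨
    (x ⊕ y) ⊖ x     ≡⟨ xyx⁻¹≈y x y ⟩
    y               ∎
    where open ≡-Reasoning

  [x⊕y]⊖[x⊕z]≡y⊖z : ∀ (x y z : Fin n) → (x ⊕ y) ⊖ (x ⊕ z) ≡ y ⊖ z
  [x⊕y]⊖[x⊕z]≡y⊖z x y z = begin
    (x ⊕ y) ⊕ neg (x ⊕ z)         ≡⟨ cong ((x ⊕ y) ⊕_) (⁻¹-∙-comm x z) ⟨
    (x ⊕ y) ⊕ (neg x ⊕ neg z)     ≡⟨ ⊕-interchange x y (neg x) (neg z) ⟩
    (x ⊖ x) ⊕ (y ⊖ z)             ≡⟨ cong (_⊕ (y ⊖ z)) (inverseʳ x) ⟩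
    Fin.zero ⊕ (y ⊖ z)            ≡⟨ identityˡ (y ⊖ z) ⟩
    y ⊖ z                         ∎
    where open ≡-Reasoning

  [x⊖[y⊕z]]⊕z≡x⊖y : ∀ (x y z : Fin n) → (x ⊖ (y ⊕ z)) ⊕ z ≡ x ⊖ y
  [x⊖[y⊕z]]⊕z≡x⊖y x y z = begin
    (x ⊕ neg (y ⊕ z)) ⊕ z       ≡⟨ cong (λ u → (x ⊕ u) ⊕ z) (⁻¹-∙-comm y z) ⟨
    (x ⊕ (neg y ⊕ neg z)) ⊕ z   ≡⟨ assoc x _ z ⟩
    x ⊕ ((neg y ⊕ neg z) ⊕ z)   ≡⟨ cong (x ⊕_) (assoc (neg y) (neg z) z) ⟩
    x ⊕ (neg y ⊕ (neg z ⊕ z))   ≡⟨ cong (λ u → x ⊕ (neg y ⊕ u)) (inverseˡ z) ⟩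
    x ⊕ (neg y ⊕ Fin.zero)      ≡⟨ cong (x ⊕_) (identityʳ (neg y)) ⟩
    x ⊖ y                       ∎
    where open ≡-Reasoning

  toℕ-⊖ : ∀ {x y : Fin n} → toℕ y ≤ toℕ x → toℕ (x ⊖ y) ≡ toℕ x ∸ toℕ y
  toℕ-⊖ {x} {y} y≤x = begin
    toℕ (x ⊖ y)       ≡⟨ cong toℕ (x≈z//y z y x z⊕y≡x) ⟨
    toℕ z             ≡⟨ toℕ-fromℕ< x∸y<n ⟩
    toℕ x ∸ toℕ y     ∎
    where
    open ≡-Reasoning
    x∸y<n : toℕ x ∸ toℕ y < n
    x∸y<n = ≤-<-trans (m∸n≤m (toℕ x) (toℕ y)) (toℕ<n x)
    z : Fin n
    z = fromℕ< x∸y<n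
    z⊕y≡x : z ⊕ y ≡ x
    z⊕y≡x = toℕ-injective (begin
      toℕ (z ⊕ y)                  ≡⟨ toℕ-⊕ z y ⟩
      (toℕ z + toℕ y) % n          ≡⟨ cong (λ u → (u + toℕ y) % n) (toℕ-fromℕ< x∸y<n) ⟩
      (toℕ x ∸ toℕ y + toℕ y) % n  ≡⟨ cong (_% n) (m∸n+n≡m y≤x) ⟩
      toℕ x % n                    ≡⟨ m<n⇒m%n≡m (toℕ<n x) ⟩
      toℕ x                        ∎)

module _ {n} (R : Subset n) (t a : Fin n) (l : ℕ) .{{_ : NonZero l}} (m : ℕ) {i : Fin n} where

  -- Smod branches on does (toℕ i <? l), which computes to toℕ i <ᵇ l. These unfoldings are
  -- stated for arbitrary n because for n = suc k the with-abstraction normalises translate.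
  Smod-< : toℕ i < l →
           Smod R t a l m i ≡ (translate i (translate t R) - (i ⊕ (a ⊕ t))) ∪ ⁅ (a ⊕ t) ⊕ℕ ((toℕ i + m) % l) ⁆
  Smod-< i<l with toℕ i <ᵇ l | <ᵇ-reflects-< (toℕ i) l
  ... | true  | _        = refl
  ... | false | ofⁿ i≮l = contradiction i<l i≮l

  Smod-≮ : toℕ i ≮ l → Smod R t a l m i ≡ translate i (translate t R)
  Smod-≮ i≮l with toℕ i <ᵇ l | <ᵇ-reflects-< (toℕ i) l
  ... | true  | ofʸ i<l = contradiction i<l i≮l
  ... | false | _       = refl

module Construction {k l' : ℕ} (l≤n : suc l' ≤ suc k) (m : ℕ) (R : Subset (suc k)) (t a : Fin (suc k)) where

  L : ℕ
  L = suc l'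

  A : Subset (suc k)
  A = translate t R

  a' : Fin (suc k)
  a' = a ⊕ t

  S : Fin (suc k) → Subset (suc k)
  S = Smod R t a L m

  rotate : ℕ → ℕ
  rotate p = (p + m) % L

  rotate<L : ∀ p → rotate p < L
  rotate<L p = m%n<n (p + m) L

  -- Computed in ℤ/L, where rotate is x ↦ x + m and the reversal p ↦ l' ∸ p is x ↦ l' − x.
  rotate-reverse-rotate : ∀ {p} → p ≤ l' → rotate (l' ∸ rotate p) ≡ l' ∸ p
  rotate-reverse-rotate {p} p≤l' =
    subst (λ q → rotate (l' ∸ rotate q) ≡ l' ∸ q) (toℕ-fromℕ< (s≤s p≤l')) (in-ℤ/L (fromℕ< (s≤s p≤l')))
    where
    M top : Fin L
    M   = fromℕ< (m%n<n m L)
    top = Fin.fromℕ l'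
    toℕ-⊕M : ∀ x → toℕ (x ⊕ M) ≡ rotate (toℕ x)
    toℕ-⊕M x = trans (toℕ-⊕ x M) (trans (cong (λ u → (toℕ x + u) % L) (toℕ-fromℕ< (m%n<n m L)))
                                          ([m+k%n]%n≡[m+k]%n (toℕ x) m L))
    toℕ-top⊖ : ∀ x → toℕ (top ⊖ x) ≡ l' ∸ toℕ x
    toℕ-top⊖ x = trans (toℕ-⊖ (subst (toℕ x ≤_) (sym (toℕ-fromℕ l')) (s≤s⁻¹ (toℕ<n x))))
                       (cong (_∸ toℕ x) (toℕ-fromℕ l'))
    in-ℤ/L : ∀ x → rotate (l' ∸ rotate (toℕ x)) ≡ l' ∸ toℕ x
    in-ℤ/L x = begin
      rotate (l' ∸ rotate (toℕ x))   ≡⟨ cong (λ u → rotate (l' ∸ u)) (toℕ-⊕M x) ⟨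
      rotate (l' ∸ toℕ (x ⊕ M))      ≡⟨ cong rotate (toℕ-top⊖ (x ⊕ M)) ⟨
      rotate (toℕ (top ⊖ (x ⊕ M)))   ≡⟨ toℕ-⊕M (top ⊖ (x ⊕ M)) ⟨
      toℕ ((top ⊖ (x ⊕ M)) ⊕ M)      ≡⟨ cong toℕ ([x⊖[y⊕z]]⊕z≡x⊖y top x M) ⟩
      toℕ (top ⊖ x)                  ≡⟨ toℕ-top⊖ x ⟩
      l' ∸ toℕ x                     ∎
      where open ≡-Reasoning

  rotate-injective : ∀ {p q} → p < L → q < L → rotate p ≡ rotate q → p ≡ q
  rotate-injective {p} {q} p<L q<L rp≡rq = begin
    p                          ≡⟨ m∸[m∸n]≡n (s≤s⁻¹ p<L) ⟨
    l' ∸ (l' ∸ p)              ≡⟨ cong (l' ∸_) (rotate-reverse-rotate (s≤s⁻¹ p<L)) ⟨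
    l' ∸ rotate (l' ∸ rotate p) ≡⟨ cong (λ u → l' ∸ rotate (l' ∸ u)) rp≡rq ⟩
    l' ∸ rotate (l' ∸ rotate q) ≡⟨ cong (l' ∸_) (rotate-reverse-rotate (s≤s⁻¹ q<L)) ⟩
    l' ∸ (l' ∸ q)              ≡⟨ m∸[m∸n]≡n (s≤s⁻¹ q<L) ⟩
    q                          ∎
    where open ≡-Reasoning

  shift : Fin (suc k) → Fin (suc k)
  shift j with toℕ j <? L
  ... | yes _ = fromℕ< (≤-trans (rotate<L (toℕ j)) l≤n)
  ... | no  _ = j

  toℕ-shift : ∀ {j} → toℕ j < L → toℕ (shift j) ≡ rotate (toℕ j)
  toℕ-shift {j} j<L with toℕ j <? L
  ... | yes _   = toℕ-fromℕ< _
  ... | no  j≮L = contradiction j<L j≮L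

  shift-≮ : ∀ {j} → toℕ j ≮ L → shift j ≡ j
  shift-≮ {j} j≮L with toℕ j <? L
  ... | yes j<L = contradiction j<L j≮L
  ... | no  _   = refl

  toℕ-shift<L : ∀ {j} → toℕ j < L → toℕ (shift j) < L
  toℕ-shift<L {j} j<L = subst (_< L) (sym (toℕ-shift j<L)) (rotate<L (toℕ j))

  -- From here on, tests on toℕ i <? L are not made with `with`: the same test occurs inside
  -- shift and S, so abstracting it is ill-typed or normalises translate, which is very slow.
  shift-injective : ∀ {i j} → shift i ≡ shift j → i ≡ j
  shift-injective {i} {j} = by-cases (toℕ i <? L) (toℕ j <? L)
    where
    by-cases : Dec (toℕ i < L) → Dec (toℕ j < L) → shift i ≡ shift j → i ≡ j
    by-cases (yes i<L) (yes j<L) si≡sj = toℕ-injective (rotate-injective i<L j<L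
      (trans (sym (toℕ-shift i<L)) (trans (cong toℕ si≡sj) (toℕ-shift j<L))))
    by-cases (yes i<L) (no j≮L) si≡sj =
      contradiction (subst (λ u → toℕ u < L) (trans si≡sj (shift-≮ j≮L)) (toℕ-shift<L i<L)) j≮L
    by-cases (no i≮L) (yes j<L) si≡sj =
      contradiction (subst (λ u → toℕ u < L) (trans (sym si≡sj) (shift-≮ i≮L)) (toℕ-shift<L j<L)) i≮L
    by-cases (no i≮L) (no j≮L) si≡sj = trans (sym (shift-≮ i≮L)) (trans si≡sj (shift-≮ j≮L))

  c : Fin (suc k)
  c = fromℕ< l≤n

  toℕ-c⊖ : ∀ {i} → toℕ i ≤ l' → toℕ (c ⊖ i) ≡ l' ∸ toℕ i
  toℕ-c⊖ {i} i≤l' = trans (toℕ-⊖ (subst (toℕ i ≤_) (sym (toℕ-fromℕ< l≤n)) i≤l')) (cong (_∸ toℕ i) (toℕ-fromℕ< l≤n))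

  toℕ-c⊖<L : ∀ {i} → toℕ i < L → toℕ (c ⊖ i) < L
  toℕ-c⊖<L {i} i<L = subst (_< L) (sym (toℕ-c⊖ (s≤s⁻¹ i<L))) (s≤s (m∸n≤m l' (toℕ i)))

  c⊖i≡shift[c⊖shift[i]] : ∀ {i} → toℕ i < L → c ⊖ i ≡ shift (c ⊖ shift i)
  c⊖i≡shift[c⊖shift[i]] {i} i<L = toℕ-injective (begin
    toℕ (c ⊖ i)                    ≡⟨ toℕ-c⊖ (s≤s⁻¹ i<L) ⟩
    l' ∸ toℕ i                     ≡⟨ rotate-reverse-rotate (s≤s⁻¹ i<L) ⟨
    rotate (l' ∸ rotate (toℕ i))   ≡⟨ cong (λ u → rotate (l' ∸ u)) (toℕ-shift i<L) ⟨
    rotate (l' ∸ toℕ (shift i))    ≡⟨ cong rotate (toℕ-c⊖ (s≤s⁻¹ (toℕ-shift<L i<L))) ⟨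
    rotate (toℕ (c ⊖ shift i))     ≡⟨ toℕ-shift (toℕ-c⊖<L (toℕ-shift<L i<L)) ⟨
    toℕ (shift (c ⊖ shift i))      ∎)
    where open ≡-Reasoning

  ι : Fin (suc k) → Fin (suc k)
  ι x = (a' ⊕ c) ⊖ x

  ι-involutive : ∀ x → ι (ι x) ≡ x
  ι-involutive = x⊖[x⊖y]≡y (a' ⊕ c)

  ι[a'⊕x]≡c⊖x : ∀ x → ι (a' ⊕ x) ≡ c ⊖ x
  ι[a'⊕x]≡c⊖x = [x⊕y]⊖[x⊕z]≡y⊖z a' c

  ι≡a'⊕[c⊖x] : ∀ x → ι x ≡ a' ⊕ (c ⊖ x)
  ι≡a'⊕[c⊖x] x = ⊕-assoc a' c (neg x)

  Removed Added Kept : Fin (suc k) → Fin (suc k) → Set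
  Removed x i = toℕ i < L × x ≡ i ⊕ a'
  Added   x i = toℕ i < L × x ≡ a' ⊕ shift i
  Kept    x i = x ∈ translate i A × ¬ Removed x i

  -- a' ⊕ℕ toℕ j and a' ⊕ j unfold to the same term.
  S-< : ∀ {i} → toℕ i < L → S i ≡ (translate i A - (i ⊕ a')) ∪ ⁅ a' ⊕ shift i ⁆
  S-< {i} i<L = trans (Smod-< R t a L m i<L)
                      (cong (λ j → (translate i A - (i ⊕ a')) ∪ ⁅ a' ⊕ℕ j ⁆) (sym (toℕ-shift i<L)))

  S-≮ : ∀ {i} → toℕ i ≮ L → S i ≡ translate i A
  S-≮ = Smod-≮ R t a L m

  ∈-S⁻ : ∀ x i → x ∈ S i → Kept x i ⊎ Added x i
  ∈-S⁻ x i x∈Si = [ below , above ]′ (toSum (toℕ i <? L))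
    where
    above : toℕ i ≮ L → Kept x i ⊎ Added x i
    above i≮L = inj₁ (subst (x ∈_) (S-≮ i≮L) x∈Si , i≮L ∘ proj₁)
    below : toℕ i < L → Kept x i ⊎ Added x i
    below i<L = [ (λ (x∈iA , x≢i⊕a') → inj₁ (x∈iA , x≢i⊕a' ∘ proj₂)) , (λ x≡a'⊕si → inj₂ (i<L , x≡a'⊕si)) ]′
      (∈-[p-y]∪⁅z⁆⁻ (translate i A) (i ⊕ a') (a' ⊕ shift i) (subst (x ∈_) (S-< i<L) x∈Si))

  ∈-S⁺ : ∀ x i → Kept x i ⊎ Added x i → x ∈ S i
  ∈-S⁺ x i (inj₁ (x∈iA , not-removed)) = [ below , above ]′ (toSum (toℕ i <? L))
    where
    above : toℕ i ≮ L → x ∈ S i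
    above i≮L = subst (x ∈_) (sym (S-≮ i≮L)) x∈iA
    below : toℕ i < L → x ∈ S i
    below i<L = subst (x ∈_) (sym (S-< i<L))
      (∈-[p-y]∪⁅z⁆⁺ (translate i A) (i ⊕ a') (a' ⊕ shift i) (inj₁ (x∈iA , λ x≡i⊕a' → not-removed (i<L , x≡i⊕a'))))
  ∈-S⁺ x i (inj₂ (i<L , x≡a'⊕si)) =
    subst (x ∈_) (sym (S-< i<L)) (∈-[p-y]∪⁅z⁆⁺ (translate i A) (i ⊕ a') (a' ⊕ shift i) (inj₂ x≡a'⊕si))

  translate-dual : ∀ x i → x ∈ translate i A → ι i ∈ translate (ι x) A
  translate-dual x i x∈iA =
    let s , s∈A , i⊕s≡x = ∈-translate⁻ i A x∈iA
        ιx⊕s≡ιi : ι x ⊕ s ≡ ι i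
        ιx⊕s≡ιi = trans (cong (λ y → ι y ⊕ s) (sym i⊕s≡x)) ([x⊖[y⊕z]]⊕z≡x⊖y (a' ⊕ c) i s)
    in subst (_∈ translate (ι x) A) ιx⊕s≡ιi (∈-translate⁺ (ι x) A s∈A)

  Removed-dual : ∀ x i → Removed x i → Removed (ι i) (ι x)
  Removed-dual x i (i<L , refl) = subst (λ j → toℕ j < L) (sym ιx≡c⊖i) (toℕ-c⊖<L i<L) , (begin
    ι i             ≡⟨ ι≡a'⊕[c⊖x] i ⟩
    a' ⊕ (c ⊖ i)    ≡⟨ ⊕-comm a' (c ⊖ i) ⟩
    (c ⊖ i) ⊕ a'    ≡⟨ cong (_⊕ a') ιx≡c⊖i ⟨
    ι x ⊕ a'        ∎)
    where
    open ≡-Reasoning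
    ιx≡c⊖i : ι (i ⊕ a') ≡ c ⊖ i
    ιx≡c⊖i = trans (cong ι (⊕-comm i a')) (ι[a'⊕x]≡c⊖x i)

  Added-dual : ∀ x i → Added x i → Added (ι i) (ι x)
  Added-dual x i (i<L , refl) = subst (λ j → toℕ j < L) (sym ιx≡c⊖si) (toℕ-c⊖<L (toℕ-shift<L i<L)) , (begin
    ι i                          ≡⟨ ι≡a'⊕[c⊖x] i ⟩
    a' ⊕ (c ⊖ i)                 ≡⟨ cong (a' ⊕_) (c⊖i≡shift[c⊖shift[i]] i<L) ⟩
    a' ⊕ shift (c ⊖ shift i)     ≡⟨ cong (λ j → a' ⊕ shift j) ιx≡c⊖si ⟨
    a' ⊕ shift (ι x)             ∎)
    where
    open ≡-Reasoning
    ιx≡c⊖si : ι (a' ⊕ shift i) ≡ c ⊖ shift i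
    ιx≡c⊖si = ι[a'⊕x]≡c⊖x (shift i)

  ∈-S-dual : ∀ x i → x ∈ S i → ι i ∈ S (ι x)
  ∈-S-dual x i x∈Si = ∈-S⁺ (ι i) (ι x) ([ kept-dual , inj₂ ∘ Added-dual x i ]′ (∈-S⁻ x i x∈Si))
    where
    Removed-undual : Removed (ι i) (ι x) → Removed x i
    Removed-undual removed = subst₂ Removed (ι-involutive x) (ι-involutive i) (Removed-dual (ι i) (ι x) removed)
    kept-dual : Kept x i → Kept (ι i) (ι x) ⊎ Added (ι i) (ι x)
    kept-dual (x∈iA , not-removed) = inj₁ (translate-dual x i x∈iA , not-removed ∘ Removed-undual)

  τ : Fin (suc k) → Fin (suc k)
  τ j = a' ⊕ shift j

  τ-injective : ∀ {i j} → τ i ≡ τ j → i ≡ j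
  τ-injective τi≡τj = shift-injective (⊕-cancelˡ a' τi≡τj)

  τ∈S : a ∈ R → ∀ j → τ j ∈ S j
  τ∈S a∈R j = ∈-S⁺ (τ j) j ([ added , kept ]′ (toSum (toℕ j <? L)))
    where
    a'∈A : a' ∈ A
    a'∈A = subst (_∈ A) (⊕-comm t a) (∈-translate⁺ t R a∈R)
    added : toℕ j < L → Kept (τ j) j ⊎ Added (τ j) j
    added j<L = inj₂ (j<L , refl)
    kept : toℕ j ≮ L → Kept (τ j) j ⊎ Added (τ j) j
    kept j≮L = inj₁ (subst (_∈ translate j A) j⊕a'≡τj (∈-translate⁺ j A a'∈A) , j≮L ∘ proj₁)
      where
      j⊕a'≡τj : j ⊕ a' ≡ τ j
      j⊕a'≡τj = trans (⊕-comm j a') (cong (a' ⊕_) (sym (shift-≮ j≮L)))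

proposition6 : (n : ℕ) (R : Subset n) → Nonempty R
    → (∀ (g h : Fin n) → translate g R ≡ translate h R → g ≡ h)
    → (t a : Fin n) → a ∈ R
    → (l : ℕ) .{{_ : NonZero l}} → l ≤ n
    → (m : ℕ) → m < n
    → SatisfiesUCC (generated (Smod R t a l m))
proposition6 (suc k) R _ _ t a a∈R (suc l') l≤n m _ =
  SelfDual.selfDual⇒UCC S ι ι-involutive (λ {x} {i} → ∈-S-dual x i) τ τ-injective (τ∈S a∈R)
  where open Construction l≤n m R t a
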